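{- Let $D=(V,A)$ be a digraph and let $\mathcal I$ be the family of all independent sets of arcs of $D$. Then $M(D)=(A,\mathcal I)$ is a graphic matroid, and its rank equals the maximum size of a set of arcs of $D$ containing no closed antidirected trail.
   Context: Digraphs are finite and loopless. For $F\subseteq A$ let $h(F)$ (resp. $t(F)$) be the number of vertices that are heads (resp. tails) of at least one arc of $F$. A set $I\subseteq A$ is independent if $|I'|\le h(I')+t(I')-1$ for all nonempty $I'\subseteq I$. In a walk (in the underlying graph) an arc $vw$ is forward if traversed from $v$ to $w$ and backward if traversed from $w$ to $v$. A closed antidirected trail is a closed walk of even length with no repeated arc whose arcs alternate between forward and backward arcs. -}

module Defs where

open import Data.Nat using (ℕ; zero; suc; _+_; _*_; _≤_)
open import Data.Fin using (Fin; zero; suc; inject₁; fromℕ)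
open import Data.Fin.Properties using (any?; _≟_)
open import Data.Fin.Subset using (Subset; _∈_; _⊆_; ∣_∣; Nonempty)
open import Data.Fin.Subset.Properties using (_∈?_)
open import Data.Vec using (tabulate)
open import Data.Product using (Σ; ∃; _×_; _,_)
open import Data.Sum using (_⊎_)
open import Relation.Nullary using (¬_; ⌊_⌋)
open import Relation.Nullary.Decidable using (_×-dec_)
open import Relation.Binary.PropositionalEquality using (_≡_; _≢_)
open import Function.Definitions using (Injective)
open import Function.Bundles using (_⇔_)

record Digraph : Set where
  field
    n m : ℕ
    tl hd : Fin m → Fin n
    loopless : ∀ a → tl a ≢ hd a

module _ (D : Digraph) where
  open Digraph D

  headSet tailSet : Subset m → Subset n
  headSet F = tabulate λ v → ⌊ any? (λ a → (a ∈? F) ×-dec (hd a ≟ v)) ⌋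
  tailSet F = tabulate λ v → ⌊ any? (λ a → (a ∈? F) ×-dec (tl a ≟ v)) ⌋

  h t : Subset m → ℕ
  h F = ∣ headSet F ∣
  t F = ∣ tailSet F ∣

  Independent : Subset m → Set
  Independent I = ∀ (I' : Subset m) → I' ⊆ I → Nonempty I' →
                  ∣ I' ∣ + 1 ≤ h I' + t I'

  -- A closed antidirected trail of length 2(k+1) with arcs in F:
  -- the walk visits u 0, w 0, u 1, w 1, …, w k, u (k+1) = u 0;
  -- arc f j is traversed forward from u j to w j,
  -- arc b j is traversed backward from w j to u (j+1);
  -- all 2(k+1) arcs are pairwise distinct.
  record ClosedAntidirectedTrail (F : Subset m) : Set where
    field
      k : ℕ
      u : Fin (suc (suc k)) → Fin n
      w : Fin (suc k) → Fin n
      f b : Fin (suc k) → Fin m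
      closed : u zero ≡ u (fromℕ (suc k))
      f-fwd : ∀ j → tl (f j) ≡ u (inject₁ j) × hd (f j) ≡ w j
      b-bwd : ∀ j → hd (b j) ≡ w j × tl (b j) ≡ u (suc j)
      f-inj : Injective _≡_ _≡_ f
      b-inj : Injective _≡_ _≡_ b
      f≢b : ∀ i j → f i ≢ b j
      f∈F : ∀ j → f j ∈ F
      b∈F : ∀ j → b j ∈ F

  NoClosedAntidirectedTrail : Subset m → Set
  NoClosedAntidirectedTrail F = ¬ ClosedAntidirectedTrail F

record Multigraph (m : ℕ) : Set where
  field
    N : ℕ
    end₁ end₂ : Fin m → Fin N

module _ {m : ℕ} (G : Multigraph m) where
  open Multigraph G

  Joins : Fin m → Fin N → Fin N → Set
  Joins e x y = (end₁ e ≡ x × end₂ e ≡ y) ⊎ (end₁ e ≡ y × end₂ e ≡ x)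

  record Cycle (F : Subset m) : Set where
    field
      L : ℕ
      x : Fin (suc (suc L)) → Fin N
      e : Fin (suc L) → Fin m
      closed : x zero ≡ x (fromℕ (suc L))
      joins : ∀ i → Joins (e i) (x (inject₁ i)) (x (suc i))
      e-inj : Injective _≡_ _≡_ e
      x-inj : Injective _≡_ _≡_ (λ (i : Fin (suc L)) → x (inject₁ i))
      e∈F : ∀ i → e i ∈ F

  -- edge sets of forests = independent sets of the cycle matroid M(G)
  Acyclic : Subset m → Set
  Acyclic F = ¬ Cycle F

IsGraphic : (m : ℕ) → (Subset m → Set) → Set
IsGraphic m 𝓘 = Σ (Multigraph m) λ G → ∀ (I : Subset m) → 𝓘 I ⇔ Acyclic G I

IsMaxSize : {m : ℕ} → (Subset m → Set) → ℕ → Set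
IsMaxSize P r = (∃ λ S → P S × ∣ S ∣ ≡ r) × (∀ S → P S → ∣ S ∣ ≤ r)

IsRank : {m : ℕ} → (Subset m → Set) → ℕ → Set
IsRank 𝓘 r = IsMaxSize 𝓘 r

-- Let G be the bipartite graph with a tail copy and a head copy of every vertex of D, the arc a becoming
-- the edge between the tail copy of tl a and the head copy of hd a. A nonempty arc set E violating
-- independence has h(E) + t(E) ≤ |E|, i.e. at least as many edges as vertices in G. Deleting an arc whose
-- tail, or head, no other arc of E shares keeps this inequality; once no such arc is left, every arc has a
-- twin at its head and one at its tail, so following twins alternately gives an unending antidirected walk.
-- By pigeonhole it closes up, and shortcutting at repeated tails and rerouting at repeated heads leaves a
-- closed antidirected walk whose tails are distinct and whose heads are distinct. Such a walk is at once a
-- closed antidirected trail of D and a cycle of G. Conversely a closed antidirected trail with 2(k+1) arcs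
-- has at most k+1 heads and k+1 tails, and a cycle of G has as many edges as vertices, so neither is
-- independent.

module Submission where

open import Defs
open import Data.Bool using (Bool; true)
open import Data.Bool.Properties using (T-≡)
open import Data.Empty using (⊥-elim)
open import Data.Fin using (Fin; zero; suc; toℕ; inject₁; fromℕ; fromℕ<; lower₁; _↑ˡ_; _↑ʳ_; splitAt; join)
open import Data.Fin.Properties
  using (any?; _≟_; ¬Fin0; 0≢1+n; suc-injective; toℕ<n; toℕ≤pred[n]; toℕ-fromℕ; toℕ-fromℕ<;
         toℕ-inject₁; toℕ-injective; inject₁-lower₁; ↑ˡ-injective; ↑ʳ-injective;
         splitAt-↑ˡ; splitAt-↑ʳ; join-splitAt; pigeonhole)
open import Data.Fin.Subset using (Subset; _∈_; _∉_; _⊆_; ∣_∣; Nonempty; inside; outside; ⊤; ⁅_⁆; _∪_; _-_)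
  renaming (⊥ to ∅)
open import Data.Fin.Subset.Properties
  using (_∈?_; _⊆?_; nonempty?; anySubset?; ⊆-trans; ∈⊤; ∉⊥; x∈⁅x⁆; x∈p∪q⁺; p─q⊆p; x∈p∧x≢y⇒x∈p-y;
         p⊆q⇒∣p∣≤∣q∣; ∣p∣≤n; ∣p∣≤∣x∷p∣; ∣⊥∣≡0; ∣⊤∣≡n; ∣⁅x⁆∣≡1; x∈p⇒∣p-x∣<∣p∣)
open import Data.Nat using (ℕ; zero; suc; _+_; _∸_; _≤_; _<_; z≤n; s≤s; _≤?_)
open import Data.Nat.Induction using (<-wellFounded)
open import Data.Nat.Properties
  using (≤-refl; ≤-reflexive; ≤-trans; ≤-pred; <⇒≤; <⇒≢; ≰⇒>; ≮⇒≥; n≤1+n; n<1+n; m≤n⇒m≤1+n;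
         m≤n⇒m<n∨m≡n; m≤n+m; m≤m+n; m+1+n≰m; +-suc; +-comm; +-identityʳ; +-mono-≤; +-monoˡ-≤;
         +-monoʳ-≤; ∸-monoʳ-<; module ≤-Reasoning)
  renaming (_≟_ to _≟ℕ_)
open import Data.Product using (Σ; ∃; ∃₂; _×_; _,_; proj₁; proj₂)
open import Data.Sum using (_⊎_; inj₁; inj₂; [_,_]′)
open import Data.Vec using (tabulate; lookup; _∷_; []; here; there)
open import Data.Vec.Properties using (lookup∘tabulate; tabulate∘lookup; []=⇒lookup; lookup⇒[]=)
open import Function using (_∘_; id)
open import Function.Bundles using (_⇔_; mk⇔; Equivalence)
open import Function.Definitions using (Injective)
open import Induction.WellFounded using (Acc; acc)
open import Relation.Binary.PropositionalEquality
  using (_≡_; _≢_; refl; sym; trans; cong; subst; module ≡-Reasoning)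
open import Relation.Nullary using (¬_; Dec; yes; no; ⌊_⌋)
open import Relation.Nullary.Decidable using (_×-dec_; _⊎-dec_; ¬?; toWitness; fromWitness; decidable-stable)

[,]∘splitAt-injective : ∀ {a b N} {f : Fin a → Fin N} {g : Fin b → Fin N} →
  Injective _≡_ _≡_ f → Injective _≡_ _≡_ g → (∀ i j → f i ≢ g j) →
  Injective _≡_ _≡_ ([ f , g ]′ ∘ splitAt a)
[,]∘splitAt-injective {a} {b} {f = f} {g} f-inj g-inj f≢g {i} {j} e =
  trans (sym (join-splitAt a b i)) (trans (cong (join a b) (split-inj (splitAt a i) (splitAt a j) e)) (join-splitAt a b j))
  where
  split-inj : ∀ x y → [ f , g ]′ x ≡ [ f , g ]′ y → x ≡ y
  split-inj (inj₁ x) (inj₁ y) e = cong inj₁ (f-inj e)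
  split-inj (inj₂ x) (inj₂ y) e = cong inj₂ (g-inj e)
  split-inj (inj₁ x) (inj₂ y) e = ⊥-elim (f≢g x y e)
  split-inj (inj₂ x) (inj₁ y) e = ⊥-elim (f≢g y x (sym e))

↑ˡ≢↑ʳ : ∀ {a b} (i : Fin a) (j : Fin b) → i ↑ˡ b ≢ a ↑ʳ j
↑ˡ≢↑ʳ {a} {b} i j e with trans (sym (splitAt-↑ˡ a i b)) (trans (cong (splitAt a) e) (splitAt-↑ʳ a b j))
... | ()

∈-tabulate⁺ : ∀ {n} (g : Fin n → Bool) {v} → g v ≡ true → v ∈ tabulate g
∈-tabulate⁺ g {v} gv = lookup⇒[]= v (tabulate g) (trans (lookup∘tabulate g v) gv)

∈-tabulate⁻ : ∀ {n} (g : Fin n → Bool) {v} → v ∈ tabulate g → g v ≡ true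
∈-tabulate⁻ g {v} v∈ = trans (sym (lookup∘tabulate g v)) ([]=⇒lookup v∈)

x∉p-x : ∀ {n} (p : Subset n) x → x ∉ p - x
x∉p-x (_ ∷ p) (suc x) (there x∈) = x∉p-x p x x∈

x∈p-y⇒x≢y : ∀ {n} {p : Subset n} {x y} → x ∈ p - y → x ≢ y
x∈p-y⇒x≢y {p = p} {x} x∈ refl = x∉p-x p x x∈

∣p∪q∣≤∣p∣+∣q∣ : ∀ {n} (p q : Subset n) → ∣ p ∪ q ∣ ≤ ∣ p ∣ + ∣ q ∣
∣p∪q∣≤∣p∣+∣q∣ [] [] = z≤n
∣p∪q∣≤∣p∣+∣q∣ (inside ∷ p) (s ∷ q) =
  s≤s (≤-trans (∣p∪q∣≤∣p∣+∣q∣ p q) (+-monoʳ-≤ ∣ p ∣ (∣p∣≤∣x∷p∣ s q)))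
∣p∪q∣≤∣p∣+∣q∣ (outside ∷ p) (inside ∷ q) =
  ≤-trans (s≤s (∣p∪q∣≤∣p∣+∣q∣ p q)) (≤-reflexive (sym (+-suc ∣ p ∣ ∣ q ∣)))
∣p∪q∣≤∣p∣+∣q∣ (outside ∷ p) (outside ∷ q) = ∣p∪q∣≤∣p∣+∣q∣ p q

∣p∣≤1+∣p-x∣ : ∀ {n} (p : Subset n) x → ∣ p ∣ ≤ suc ∣ p - x ∣
∣p∣≤1+∣p-x∣ p x = begin
  ∣ p ∣                  ≤⟨ p⊆q⇒∣p∣≤∣q∣ p⊆p-x∪x ⟩
  ∣ (p - x) ∪ ⁅ x ⁆ ∣    ≤⟨ ∣p∪q∣≤∣p∣+∣q∣ (p - x) ⁅ x ⁆ ⟩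
  ∣ p - x ∣ + ∣ ⁅ x ⁆ ∣  ≡⟨ cong (∣ p - x ∣ +_) (∣⁅x⁆∣≡1 x) ⟩
  ∣ p - x ∣ + 1          ≡⟨ +-comm ∣ p - x ∣ 1 ⟩
  suc ∣ p - x ∣          ∎
  where
  open ≤-Reasoning
  p⊆p-x∪x : p ⊆ (p - x) ∪ ⁅ x ⁆
  p⊆p-x∪x {y} y∈p with y ≟ x
  ... | yes refl = x∈p∪q⁺ (inj₂ (x∈⁅x⁆ x))
  ... | no y≢x = x∈p∪q⁺ (inj₁ (x∈p∧x≢y⇒x∈p-y y∈p y≢x))

0<∣p∣⇒nonempty : ∀ {n} (p : Subset n) → 0 < ∣ p ∣ → Nonempty p
0<∣p∣⇒nonempty (inside ∷ p) _ = zero , here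
0<∣p∣⇒nonempty (outside ∷ p) 0<∣p∣ with 0<∣p∣⇒nonempty p 0<∣p∣
... | x , x∈p = suc x , there x∈p

leftPart : ∀ {a} b → Subset (a + b) → Subset a
leftPart b p = tabulate λ v → lookup p (v ↑ˡ b)

rightPart : ∀ a {b} → Subset (a + b) → Subset b
rightPart a p = tabulate λ v → lookup p (a ↑ʳ v)

∣p∣≡∣leftPart∣+∣rightPart∣ : ∀ a b (p : Subset (a + b)) → ∣ p ∣ ≡ ∣ leftPart b p ∣ + ∣ rightPart a p ∣
∣p∣≡∣leftPart∣+∣rightPart∣ zero b p rewrite tabulate∘lookup p = refl
∣p∣≡∣leftPart∣+∣rightPart∣ (suc a) b (inside ∷ p) = cong suc (∣p∣≡∣leftPart∣+∣rightPart∣ a b p)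
∣p∣≡∣leftPart∣+∣rightPart∣ (suc a) b (outside ∷ p) = ∣p∣≡∣leftPart∣+∣rightPart∣ a b p

∈-leftPart : ∀ {a} b {p : Subset (a + b)} {v} → v ↑ˡ b ∈ p → v ∈ leftPart b p
∈-leftPart b v∈ = ∈-tabulate⁺ _ ([]=⇒lookup v∈)

∈-rightPart : ∀ a {b} {p : Subset (a + b)} {v} → a ↑ʳ v ∈ p → v ∈ rightPart a p
∈-rightPart a v∈ = ∈-tabulate⁺ _ ([]=⇒lookup v∈)

largest : ∀ {N} {P : Subset N → Set} → (∀ S → Dec (P S)) → ∀ {S} → P S →
  ∃ λ S* → P S* × (∀ S → P S → ∣ S ∣ ≤ ∣ S* ∣)
largest {N} {P} P? {S} pS = climb (<-wellFounded (N ∸ ∣ S ∣)) pS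
  where
  climb : ∀ {S} → Acc _<_ (N ∸ ∣ S ∣) → P S → ∃ λ S* → P S* × (∀ S → P S → ∣ S ∣ ≤ ∣ S* ∣)
  climb {S} (acc smaller) pS with anySubset? (λ S′ → P? S′ ×-dec (suc ∣ S ∣ ≤? ∣ S′ ∣))
  ... | yes (S′ , pS′ , bigger) = climb (smaller (∸-monoʳ-< bigger (∣p∣≤n S′))) pS′
  ... | no none = S , pS , λ S′ pS′ → ≮⇒≥ (λ bigger → none (S′ , pS′ , bigger))

image : ∀ {m n} → (Fin m → Fin n) → Subset m → Subset n
image sel p = tabulate λ v → ⌊ any? (λ a → (a ∈? p) ×-dec (sel a ≟ v)) ⌋

range : ∀ {m n} → (Fin m → Fin n) → Subset n
range g = image g ⊤

module _ {m n} (sel : Fin m → Fin n) where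

  ∈-image⁺ : ∀ {p a} → a ∈ p → sel a ∈ image sel p
  ∈-image⁺ {p} {a} a∈p = ∈-tabulate⁺ _ (Equivalence.to T-≡ (fromWitness (a , a∈p , refl)))

  ∈-image⁻ : ∀ {p v} → v ∈ image sel p → ∃ λ a → a ∈ p × sel a ≡ v
  ∈-image⁻ {p} {v} v∈ = toWitness (Equivalence.from T-≡ (∈-tabulate⁻ _ v∈))

  image-mono : ∀ {p q} → p ⊆ q → image sel p ⊆ image sel q
  image-mono p⊆q v∈ with ∈-image⁻ v∈
  ... | a , a∈p , refl = ∈-image⁺ (p⊆q a∈p)

  ∈-range : ∀ a → sel a ∈ range sel
  ∈-range a = ∈-image⁺ ∈⊤

image-∷ : ∀ {m n} (sel : Fin (suc m) → Fin n) {s p v} → v ∈ image sel (s ∷ p) →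
  (s ≡ inside × sel zero ≡ v) ⊎ v ∈ image (sel ∘ suc) p
image-∷ sel v∈ with ∈-image⁻ sel v∈
... | zero , here , sel0≡v = inj₁ (refl , sel0≡v)
... | suc a , there a∈p , refl = inj₂ (∈-image⁺ (sel ∘ suc) a∈p)

image-suc⊆ : ∀ {m n} (sel : Fin (suc m) → Fin n) {s p} → image (sel ∘ suc) p ⊆ image sel (s ∷ p)
image-suc⊆ sel v∈ with ∈-image⁻ (sel ∘ suc) v∈
... | a , a∈p , refl = ∈-image⁺ sel (there a∈p)

∣image∣≤∣p∣ : ∀ {m n} (sel : Fin m → Fin n) p → ∣ image sel p ∣ ≤ ∣ p ∣
∣image∣≤∣p∣ {n = n} sel [] = ≤-trans (p⊆q⇒∣p∣≤∣q∣ {p = image sel []} image⊆∅) (≤-reflexive (∣⊥∣≡0 n))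
  where
  image⊆∅ : image sel [] ⊆ ∅
  image⊆∅ v∈ = ⊥-elim (¬Fin0 (proj₁ (∈-image⁻ sel {p = []} v∈)))
∣image∣≤∣p∣ sel (outside ∷ p) =
  ≤-trans (p⊆q⇒∣p∣≤∣q∣ {p = image sel (outside ∷ p)} shrink) (∣image∣≤∣p∣ (sel ∘ suc) p)
  where
  shrink : image sel (outside ∷ p) ⊆ image (sel ∘ suc) p
  shrink v∈ with image-∷ sel v∈
  ... | inj₁ (() , _)
  ... | inj₂ v∈′ = v∈′
∣image∣≤∣p∣ sel (inside ∷ p) = begin
  ∣ image sel (inside ∷ p) ∣            ≤⟨ ∣p∣≤1+∣p-x∣ (image sel (inside ∷ p)) (sel zero) ⟩
  suc ∣ image sel (inside ∷ p) - sel zero ∣ ≤⟨ s≤s (p⊆q⇒∣p∣≤∣q∣ {p = image sel (inside ∷ p) - sel zero} shrink) ⟩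
  suc ∣ image (sel ∘ suc) p ∣           ≤⟨ s≤s (∣image∣≤∣p∣ (sel ∘ suc) p) ⟩
  suc ∣ p ∣                             ∎
  where
  open ≤-Reasoning
  shrink : image sel (inside ∷ p) - sel zero ⊆ image (sel ∘ suc) p
  shrink v∈ with image-∷ sel (p─q⊆p _ _ v∈)
  ... | inj₁ (_ , refl) = ⊥-elim (x∈p-y⇒x≢y v∈ refl)
  ... | inj₂ v∈′ = v∈′

∣p∣≤∣image∣ : ∀ {m n} {sel : Fin m → Fin n} → Injective _≡_ _≡_ sel → ∀ p → ∣ p ∣ ≤ ∣ image sel p ∣
∣p∣≤∣image∣ sel-inj [] = z≤n
∣p∣≤∣image∣ {sel = sel} sel-inj (outside ∷ p) =
  ≤-trans (∣p∣≤∣image∣ (suc-injective ∘ sel-inj) p)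
          (p⊆q⇒∣p∣≤∣q∣ {p = image (sel ∘ suc) p} (image-suc⊆ sel {outside} {p}))
∣p∣≤∣image∣ {sel = sel} sel-inj (inside ∷ p) = begin
  suc ∣ p ∣                                 ≤⟨ s≤s (∣p∣≤∣image∣ (suc-injective ∘ sel-inj) p) ⟩
  suc ∣ image (sel ∘ suc) p ∣               ≤⟨ s≤s (p⊆q⇒∣p∣≤∣q∣ {p = image (sel ∘ suc) p} grow) ⟩
  suc ∣ image sel (inside ∷ p) - sel zero ∣ ≤⟨ x∈p⇒∣p-x∣<∣p∣ (∈-image⁺ sel here) ⟩
  ∣ image sel (inside ∷ p) ∣                ∎
  where
  open ≤-Reasoning
  grow : image (sel ∘ suc) p ⊆ image sel (inside ∷ p) - sel zero
  grow v∈ with ∈-image⁻ (sel ∘ suc) v∈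
  ... | a , a∈p , refl = x∈p∧x≢y⇒x∈p-y (∈-image⁺ sel (there a∈p)) (λ e → 0≢1+n (sym (sel-inj e)))

∣range∣≤ : ∀ {m n} (g : Fin m → Fin n) → ∣ range g ∣ ≤ m
∣range∣≤ {m} g = ≤-trans (∣image∣≤∣p∣ g ⊤) (≤-reflexive (∣⊤∣≡n m))

≤∣range∣ : ∀ {m n} {g : Fin m → Fin n} → Injective _≡_ _≡_ g → m ≤ ∣ range g ∣
≤∣range∣ {m} g-inj = ≤-trans (≤-reflexive (sym (∣⊤∣≡n m))) (∣p∣≤∣image∣ g-inj ⊤)

closed⇒∈range : ∀ {k N} (x : Fin (suc (suc k)) → Fin N) → x zero ≡ x (fromℕ (suc k)) →
  ∀ i → x i ∈ range (x ∘ inject₁)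
closed⇒∈range {k} x closed i with suc k ≟ℕ toℕ i
... | no k≢i =
  subst (_∈ range (x ∘ inject₁)) (cong x (inject₁-lower₁ i k≢i)) (∈-range (x ∘ inject₁) (lower₁ i k≢i))
... | yes k≡i = subst (_∈ range (x ∘ inject₁)) (trans closed (cong x last≡i)) (∈-range (x ∘ inject₁) zero)
  where
  last≡i : fromℕ (suc k) ≡ i
  last≡i = toℕ-injective (trans (toℕ-fromℕ (suc k)) k≡i)

InjectiveOn : ∀ {A : Set} → ℕ → (ℕ → A) → Set
InjectiveOn K g = ∀ {i j} → i ≤ K → j ≤ K → g i ≡ g j → i ≡ j

-- q > p is written as suc (d + p) so that shifting indices by p commutes with suc definitionally.
RepeatsOn : ∀ {A : Set} → ℕ → (ℕ → A) → Set
RepeatsOn K g = ∃₂ λ p d → suc (d + p) ≤ K × g p ≡ g (suc (d + p))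

<⇒≡suc+ : ∀ {p q} → p < q → ∃ λ d → suc (d + p) ≡ q
<⇒≡suc+ {zero} {suc q} _ = q , cong suc (+-identityʳ q)
<⇒≡suc+ {suc p} (s≤s p<q) with <⇒≡suc+ p<q
... | d , d+p≡q = d , cong suc (trans (+-suc d p) d+p≡q)

injectiveOn⊎repeatsOn : ∀ {k} (g : ℕ → Fin k) K → InjectiveOn K g ⊎ RepeatsOn K g
injectiveOn⊎repeatsOn g zero = inj₁ λ { z≤n z≤n _ → refl }
injectiveOn⊎repeatsOn g (suc K) with injectiveOn⊎repeatsOn g K
... | inj₂ (p , d , bound , e) = inj₂ (p , d , m≤n⇒m≤1+n bound , e)
... | inj₁ g-inj with any? (λ (i : Fin (suc K)) → g (toℕ i) ≟ g (suc K))
...   | yes (i , e) with <⇒≡suc+ (toℕ<n i)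
...     | d , last = inj₂ (toℕ i , d , ≤-reflexive last , trans e (cong g (sym last)))
injectiveOn⊎repeatsOn g (suc K) | inj₁ g-inj | no none = inj₁ g-inj′
  where
  earlier≢last : ∀ {i} → i < suc K → g i ≢ g (suc K)
  earlier≢last i< e = none (fromℕ< i< , subst (λ x → g x ≡ g (suc K)) (sym (toℕ-fromℕ< i<)) e)
  g-inj′ : InjectiveOn (suc K) g
  g-inj′ i≤ j≤ e with m≤n⇒m<n∨m≡n i≤ | m≤n⇒m<n∨m≡n j≤
  ... | inj₁ i< | inj₁ j< = g-inj (≤-pred i<) (≤-pred j<) e
  ... | inj₁ i< | inj₂ refl = ⊥-elim (earlier≢last i< e)
  ... | inj₂ refl | inj₁ j< = ⊥-elim (earlier≢last j< (sym e))
  ... | inj₂ refl | inj₂ refl = refl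

twice : ℕ → ℕ
twice zero = zero
twice (suc j) = suc (suc (twice j))

data Parity : ℕ → Set where
  even : ∀ j → Parity (twice j)
  odd : ∀ j → Parity (suc (twice j))

parity : ∀ t → Parity t
parity zero = even zero
parity (suc t) with parity t
... | even j = odd j
... | odd j = even (suc j)

twice-<⁻ : ∀ {j K} → twice j < twice (suc K) → j ≤ K
twice-<⁻ {zero} _ = z≤n
twice-<⁻ {suc j} {suc K} (s≤s (s≤s lt)) = s≤s (twice-<⁻ lt)

suc-twice-<⁻ : ∀ {j K} → suc (twice j) < twice (suc K) → j ≤ K
suc-twice-<⁻ lt = twice-<⁻ (≤-trans (n≤1+n _) lt)

interleave : ∀ {A : Set} → (ℕ → A) → (ℕ → A) → ℕ → A
interleave f g zero = f zero
interleave f g (suc t) = interleave g (f ∘ suc) t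

interleave-twice : ∀ {A : Set} (f g : ℕ → A) j → interleave f g (twice j) ≡ f j
interleave-twice f g zero = refl
interleave-twice f g (suc j) = interleave-twice (f ∘ suc) (g ∘ suc) j

interleave-suc-twice : ∀ {A : Set} (f g : ℕ → A) j → interleave f g (suc (twice j)) ≡ g j
interleave-suc-twice f g = interleave-twice g (f ∘ suc)

replaceAt : ∀ {A : Set} → ℕ → A → (ℕ → A) → ℕ → A
replaceAt d a g j with j ≟ℕ d
... | yes _ = a
... | no _ = g j

replaceAt-≡ : ∀ {A : Set} d (a : A) g → replaceAt d a g d ≡ a
replaceAt-≡ d a g with d ≟ℕ d
... | yes _ = refl
... | no d≢d = ⊥-elim (d≢d refl)

replaceAt-≢ : ∀ {A : Set} {d j} (a : A) g → j ≢ d → replaceAt d a g j ≡ g j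
replaceAt-≢ {d = d} {j} a g j≢d with j ≟ℕ d
... | yes j≡d = ⊥-elim (j≢d j≡d)
... | no _ = refl

-- Leaves

HasTwin : ∀ {m n} → (Fin m → Fin n) → Subset m → Fin m → Set
HasTwin s E a = ∃ λ a′ → a′ ∈ E × a′ ≢ a × s a′ ≡ s a

hasTwin? : ∀ {m n} (s : Fin m → Fin n) E a → Dec (HasTwin s E a)
hasTwin? s E a = any? λ a′ → (a′ ∈? E) ×-dec ¬? (a′ ≟ a) ×-dec (s a′ ≟ s a)

-- Deleting an arc whose s-end no other arc shares lowers ∣ image s E ∣ and ∣ E ∣ alike.
removeLeaf : ∀ {m n} (s o : Fin m → Fin n) {E a} → a ∈ E → ¬ HasTwin s E a →
  ∣ image s E ∣ + ∣ image o E ∣ ≤ ∣ E ∣ →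
  ∣ image s (E - a) ∣ + ∣ image o (E - a) ∣ ≤ ∣ E - a ∣ × Nonempty (E - a)
removeLeaf s o {E} {a} a∈E no-twin deficient =
  ≤-trans (+-monoʳ-≤ ∣ image s (E - a) ∣ o-shrinks) key ,
  0<∣p∣⇒nonempty (E - a) (≤-trans 0<∣image-o∣ (≤-trans (m≤n+m _ _) key))
  where
  open ≤-Reasoning
  E-a⊆E : E - a ⊆ E
  E-a⊆E = p─q⊆p E ⁅ a ⁆
  s-shrinks : image s (E - a) ⊆ image s E - s a
  s-shrinks v∈ with ∈-image⁻ s {p = E - a} v∈
  ... | a′ , a′∈ , refl =
    x∈p∧x≢y⇒x∈p-y (∈-image⁺ s (E-a⊆E a′∈)) λ same → no-twin (a′ , E-a⊆E a′∈ , x∈p-y⇒x≢y a′∈ , same)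
  s-drops : suc ∣ image s (E - a) ∣ ≤ ∣ image s E ∣
  s-drops = ≤-trans (s≤s (p⊆q⇒∣p∣≤∣q∣ {p = image s (E - a)} s-shrinks)) (x∈p⇒∣p-x∣<∣p∣ (∈-image⁺ s a∈E))
  o-shrinks : ∣ image o (E - a) ∣ ≤ ∣ image o E ∣
  o-shrinks = p⊆q⇒∣p∣≤∣q∣ {p = image o (E - a)} (image-mono o E-a⊆E)
  key : ∣ image s (E - a) ∣ + ∣ image o E ∣ ≤ ∣ E - a ∣
  key = ≤-pred (begin
    suc ∣ image s (E - a) ∣ + ∣ image o E ∣ ≤⟨ +-monoˡ-≤ ∣ image o E ∣ s-drops ⟩
    ∣ image s E ∣ + ∣ image o E ∣           ≤⟨ deficient ⟩
    ∣ E ∣                                   ≤⟨ ∣p∣≤1+∣p-x∣ E a ⟩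
    suc ∣ E - a ∣                           ∎)
  0<∣image-o∣ : 0 < ∣ image o E ∣
  0<∣image-o∣ = ≤-trans (s≤s z≤n) (x∈p⇒∣p-x∣<∣p∣ (∈-image⁺ o a∈E))

module _ (D : Digraph) where
  open Digraph D

  Deficient : Subset m → Set
  Deficient E = h D E + t D E ≤ ∣ E ∣

  Dependent : Subset m → Set
  Dependent F = ∃ λ E → E ⊆ F × Nonempty E × Deficient E

  dependent⇒¬independent : ∀ {F} → Dependent F → ¬ Independent D F
  dependent⇒¬independent (E , E⊆F , nonempty , deficient) independent =
    m+1+n≰m ∣ E ∣ (≤-trans (independent E E⊆F nonempty) deficient)

  independent⊎dependent : ∀ F → Independent D F ⊎ Dependent F
  independent⊎dependent F with anySubset? (λ E → (E ⊆? F) ×-dec nonempty? E ×-dec (h D E + t D E ≤? ∣ E ∣))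
  ... | yes dependent = inj₂ dependent
  ... | no none = inj₁ λ E E⊆F nonempty →
    ≤-trans (≤-reflexive (+-comm ∣ E ∣ 1)) (≰⇒> λ deficient → none (E , E⊆F , nonempty , deficient))

  independent? : ∀ F → Dec (Independent D F)
  independent? F with independent⊎dependent F
  ... | inj₁ independent = yes independent
  ... | inj₂ dependent = no (dependent⇒¬independent dependent)

  ∅-independent : Independent D ∅
  ∅-independent E E⊆∅ (_ , x∈E) = ⊥-elim (∉⊥ (E⊆∅ x∈E))

  -- Closed antidirected walks

  -- f 0, b 0, f 1, b 1, … is the arc sequence of an antidirected walk: f j is traversed forward
  -- from tl (f j) to hd (f j) = hd (b j), then b j backward to tl (b j) = tl (f (suc j)).
  record AltWalk (F : Subset m) (K : ℕ) : Set where
    field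
      f b : ℕ → Fin m
      f∈F : ∀ {j} → j ≤ K → f j ∈ F
      b∈F : ∀ {j} → j ≤ K → b j ∈ F
      hd-b : ∀ {j} → j ≤ K → hd (b j) ≡ hd (f j)
      tl-b : ∀ {j} → j < K → tl (b j) ≡ tl (f (suc j))
      f≢b : ∀ {j} → j ≤ K → f j ≢ b j
      b≢f : ∀ {j} → j < K → b j ≢ f (suc j)

  record ClosedAltWalk (F : Subset m) (K : ℕ) : Set where
    field
      walk : AltWalk F K
    open AltWalk walk public
    field
      closed : tl (b K) ≡ tl (f zero)

    tailAt : ℕ → Fin n
    tailAt zero = tl (f zero)
    tailAt (suc j) = tl (b j)

    tailAt-f : ∀ {j} → j ≤ K → tailAt j ≡ tl (f j)
    tailAt-f {zero} _ = refl
    tailAt-f {suc j} j<K = tl-b j<K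

    Simple : Set
    Simple = InjectiveOn K (tl ∘ f) × InjectiveOn K (hd ∘ f)

  SimpleClosedAltWalk : Subset m → Set
  SimpleClosedAltWalk F = ∃₂ λ K (W : ClosedAltWalk F K) → ClosedAltWalk.Simple W

  closeAt : ∀ {F K} (W : AltWalk F K) p d → suc (d + p) ≤ K →
    tl (AltWalk.f W p) ≡ tl (AltWalk.f W (suc (d + p))) → ClosedAltWalk F d
  closeAt {F} {K} W p d bound repeat = record { walk = segment ; closed = trans (tl-b (within ≤-refl)) (sym repeat) }
    where
    open AltWalk W
    within : ∀ {j} → j ≤ d → j + p < K
    within j≤d = ≤-trans (s≤s (+-monoˡ-≤ p j≤d)) bound
    segment : AltWalk F d
    segment = record
      { f = f ∘ (_+ p)
      ; b = b ∘ (_+ p)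
      ; f∈F = λ j≤d → f∈F (<⇒≤ (within j≤d))
      ; b∈F = λ j≤d → b∈F (<⇒≤ (within j≤d))
      ; hd-b = λ j≤d → hd-b (<⇒≤ (within j≤d))
      ; tl-b = λ j<d → tl-b (within (<⇒≤ j<d))
      ; f≢b = λ j≤d → f≢b (<⇒≤ (within j≤d))
      ; b≢f = λ j<d → b≢f (within (<⇒≤ j<d))
      }

  -- A repeated head hd (f p) = hd (f q), q = suc (d + p), splits off the closed walk that starts at
  -- tl (f (suc p)), runs along f (suc p), b (suc p), …, f q and returns from hd (f q) = hd (f p) along b p.
  reroute : ∀ {F K} (W : ClosedAltWalk F K) → InjectiveOn K (tl ∘ ClosedAltWalk.f W) → ∀ p d → suc (d + p) ≤ K →
    hd (ClosedAltWalk.f W p) ≡ hd (ClosedAltWalk.f W (suc (d + p))) → ClosedAltWalk F d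
  reroute {F} {K} W tl-inj p d bound repeat = record { walk = detour ; closed = trans (cong tl b′-last) (tl-b p<K) }
    where
    open ClosedAltWalk W
    within : ∀ {j} → j ≤ d → suc (j + p) ≤ K
    within j≤d = ≤-trans (s≤s (+-monoˡ-≤ p j≤d)) bound
    p<K : p < K
    p<K = ≤-trans (s≤s (m≤n+m p d)) bound
    b′ : ℕ → Fin m
    b′ = replaceAt d (b p) λ j → b (suc (j + p))
    b′-last : b′ d ≡ b p
    b′-last = replaceAt-≡ d (b p) _
    b′-< : ∀ {j} → j < d → b′ j ≡ b (suc (j + p))
    b′-< j<d = replaceAt-≢ (b p) _ (<⇒≢ j<d)
    f-last≢b-p : f (suc (d + p)) ≢ b p
    f-last≢b-p f≡b = b≢f p<K (sym (subst (λ q → f q ≡ b p) last≡p+1 f≡b))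
      where
      last≡p+1 : suc (d + p) ≡ suc p
      last≡p+1 = tl-inj (within ≤-refl) p<K (trans (cong tl f≡b) (tl-b p<K))
    b′∈F : ∀ {j} → j ≤ d → b′ j ∈ F
    b′∈F j≤d with m≤n⇒m<n∨m≡n j≤d
    ... | inj₁ j<d = subst (_∈ F) (sym (b′-< j<d)) (b∈F (within (<⇒≤ j<d)))
    ... | inj₂ refl = subst (_∈ F) (sym b′-last) (b∈F (<⇒≤ p<K))
    hd-b′ : ∀ {j} → j ≤ d → hd (b′ j) ≡ hd (f (suc (j + p)))
    hd-b′ j≤d with m≤n⇒m<n∨m≡n j≤d
    ... | inj₁ j<d = trans (cong hd (b′-< j<d)) (hd-b (within (<⇒≤ j<d)))
    ... | inj₂ refl = trans (cong hd b′-last) (trans (hd-b (<⇒≤ p<K)) repeat)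
    f≢b′ : ∀ {j} → j ≤ d → f (suc (j + p)) ≢ b′ j
    f≢b′ j≤d f≡b′ with m≤n⇒m<n∨m≡n j≤d
    ... | inj₁ j<d = f≢b (within (<⇒≤ j<d)) (trans f≡b′ (b′-< j<d))
    ... | inj₂ refl = f-last≢b-p (trans f≡b′ b′-last)
    detour : AltWalk F d
    detour = record
      { f = λ j → f (suc (j + p))
      ; b = b′
      ; f∈F = λ j≤d → f∈F (within j≤d)
      ; b∈F = b′∈F
      ; hd-b = hd-b′
      ; tl-b = λ j<d → trans (cong tl (b′-< j<d)) (tl-b (within j<d))
      ; f≢b = f≢b′
      ; b≢f = λ j<d b′≡f → b≢f (within j<d) (trans (sym (b′-< j<d)) b′≡f)
      }

  simplify : ∀ {F K} → Acc _<_ K → ClosedAltWalk F K → SimpleClosedAltWalk F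
  simplify {K = K} (acc shorter) W with injectiveOn⊎repeatsOn (tl ∘ ClosedAltWalk.f W) K
  ... | inj₂ (p , d , bound , repeat) =
    simplify (shorter (≤-trans (s≤s (m≤m+n d p)) bound)) (closeAt (ClosedAltWalk.walk W) p d bound repeat)
  ... | inj₁ tl-inj with injectiveOn⊎repeatsOn (hd ∘ ClosedAltWalk.f W) K
  ...   | inj₂ (p , d , bound , repeat) =
    simplify (shorter (≤-trans (s≤s (m≤m+n d p)) bound)) (reroute W tl-inj p d bound repeat)
  ...   | inj₁ hd-inj = K , W , tl-inj , hd-inj

  -- From a dependent set to a simple closed walk

  LeafFree : Subset m → Set
  LeafFree E = ∀ {a} → a ∈ E → HasTwin tl E a × HasTwin hd E a

  leafFree⊎leaf : ∀ E → LeafFree E ⊎ ∃ λ a → a ∈ E × (¬ HasTwin tl E a ⊎ ¬ HasTwin hd E a)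
  leafFree⊎leaf E with any? (λ a → (a ∈? E) ×-dec (¬? (hasTwin? tl E a) ⊎-dec ¬? (hasTwin? hd E a)))
  ... | yes leaf = inj₂ leaf
  ... | no none = inj₁ λ {a} a∈E →
    decidable-stable (hasTwin? tl E a) (λ no-twin → none (a , a∈E , inj₁ no-twin)) ,
    decidable-stable (hasTwin? hd E a) (λ no-twin → none (a , a∈E , inj₂ no-twin))

  removeLeaf-deficient : ∀ {E a} → a ∈ E → ¬ HasTwin tl E a ⊎ ¬ HasTwin hd E a → Deficient E →
    Deficient (E - a) × Nonempty (E - a)
  removeLeaf-deficient {E} {a} a∈E (inj₂ hd-leaf) deficient = removeLeaf hd tl a∈E hd-leaf deficient
  removeLeaf-deficient {E} {a} a∈E (inj₁ tl-leaf) deficient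
    with removeLeaf tl hd a∈E tl-leaf (subst (_≤ ∣ E ∣) (+-comm (h D E) (t D E)) deficient)
  ... | deficient′ , nonempty = subst (_≤ ∣ E - a ∣) (+-comm (t D (E - a)) (h D (E - a))) deficient′ , nonempty

  pruneLeaves : ∀ {E} → Acc _<_ ∣ E ∣ → Nonempty E → Deficient E →
    ∃ λ E′ → E′ ⊆ E × Nonempty E′ × LeafFree E′
  pruneLeaves {E} (acc smaller) nonempty deficient with leafFree⊎leaf E
  ... | inj₁ leafFree = E , id , nonempty , leafFree
  ... | inj₂ (a , a∈E , leaf) with removeLeaf-deficient a∈E leaf deficient
  ...   | deficient′ , nonempty′ with pruneLeaves (smaller (x∈p⇒∣p-x∣<∣p∣ a∈E)) nonempty′ deficient′
  ...     | E′ , E′⊆E-a , rest = E′ , ⊆-trans E′⊆E-a (p─q⊆p E ⁅ a ⁆) , rest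

  leafFreeWalk : ∀ {E F} → E ⊆ F → LeafFree E → ∀ {a} → a ∈ E → ∀ K → AltWalk F K
  leafFreeWalk {E} E⊆F leafFree {a} a∈E K = record
    { f = proj₁ ∘ fwd
    ; b = proj₁ ∘ bwd
    ; f∈F = λ {j} _ → E⊆F (proj₂ (fwd j))
    ; b∈F = λ {j} _ → E⊆F (proj₂ (bwd j))
    ; hd-b = λ {j} _ → twin-≡ hd (proj₂ ∘ leafFree) (fwd j)
    ; tl-b = λ {j} _ → sym (twin-≡ tl (proj₁ ∘ leafFree) (bwd j))
    ; f≢b = λ {j} _ f≡b → twin-≢ hd (proj₂ ∘ leafFree) (fwd j) (sym f≡b)
    ; b≢f = λ {j} _ b≡f → twin-≢ tl (proj₁ ∘ leafFree) (bwd j) (sym b≡f)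
    }
    where
    Arc : Set
    Arc = Σ (Fin m) (_∈ E)
    module _ (s : Fin m → Fin n) (twins : ∀ {a} → a ∈ E → HasTwin s E a) where
      twin : Arc → Arc
      twin (a , a∈E) = proj₁ (twins a∈E) , proj₁ (proj₂ (twins a∈E))
      twin-≢ : ∀ x → proj₁ (twin x) ≢ proj₁ x
      twin-≢ (a , a∈E) = proj₁ (proj₂ (proj₂ (twins a∈E)))
      twin-≡ : ∀ x → s (proj₁ (twin x)) ≡ s (proj₁ x)
      twin-≡ (a , a∈E) = proj₂ (proj₂ (proj₂ (twins a∈E)))
    fwd bwd : ℕ → Arc
    fwd zero = a , a∈E
    fwd (suc j) = twin tl (proj₁ ∘ leafFree) (bwd j)
    bwd j = twin hd (proj₂ ∘ leafFree) (fwd j)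

  closeUp : ∀ {F} → AltWalk F n → ∃ (ClosedAltWalk F)
  closeUp W with pigeonhole (n<1+n n) (λ (i : Fin (suc n)) → tl (AltWalk.f W (toℕ i)))
  ... | i , j , i<j , repeat with <⇒≡suc+ i<j
  ...   | d , last = d , closeAt W (toℕ i) d (≤-trans (≤-reflexive last) (toℕ≤pred[n] j))
                             (trans repeat (cong (tl ∘ AltWalk.f W) (sym last)))

  dependent⇒simpleClosedAltWalk : ∀ {F} → Dependent F → SimpleClosedAltWalk F
  dependent⇒simpleClosedAltWalk (E , E⊆F , nonempty , deficient)
    with pruneLeaves (<-wellFounded ∣ E ∣) nonempty deficient
  ... | E′ , E′⊆E , (a , a∈E′) , leafFree with closeUp (leafFreeWalk (⊆-trans E′⊆E E⊆F) leafFree a∈E′ n)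
  ...   | d , W = simplify (<-wellFounded d) W

  -- Simple closed walks, trails and cycles

  bipartiteGraph : Multigraph m
  bipartiteGraph = record { N = n + n ; end₁ = λ a → tl a ↑ˡ n ; end₂ = λ a → n ↑ʳ hd a }

  module SimpleWalk {F K} (W : ClosedAltWalk F K) (simple : ClosedAltWalk.Simple W) where
    open ClosedAltWalk W
    private
      tl-inj : InjectiveOn K (tl ∘ f)
      tl-inj = proj₁ simple
      hd-inj : InjectiveOn K (hd ∘ f)
      hd-inj = proj₂ simple

    f-injective : InjectiveOn K f
    f-injective i≤K j≤K fi≡fj = tl-inj i≤K j≤K (cong tl fi≡fj)

    b-injective : InjectiveOn K b
    b-injective i≤K j≤K bi≡bj = hd-inj i≤K j≤K (trans (sym (hd-b i≤K)) (trans (cong hd bi≡bj) (hd-b j≤K)))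

    f≢b-everywhere : ∀ {i j} → i ≤ K → j ≤ K → f i ≢ b j
    f≢b-everywhere {i} {j} i≤K j≤K fi≡bj = f≢b j≤K (subst (λ i → f i ≡ b j) i≡j fi≡bj)
      where
      i≡j : i ≡ j
      i≡j = hd-inj i≤K j≤K (trans (cong hd fi≡bj) (hd-b j≤K))

    trail : ClosedAntidirectedTrail D F
    trail = record
      { k = K
      ; u = tailAt ∘ toℕ
      ; w = hd ∘ f ∘ toℕ
      ; f = f ∘ toℕ
      ; b = b ∘ toℕ
      ; closed = trans (sym closed) (cong (tl ∘ b) (sym (toℕ-fromℕ K)))
      ; f-fwd = λ j → sym (trans (cong tailAt (toℕ-inject₁ j)) (tailAt-f (≤K j))) , refl
      ; b-bwd = λ j → hd-b (≤K j) , refl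
      ; f-inj = λ {i} {j} fi≡fj → toℕ-injective (f-injective (≤K i) (≤K j) fi≡fj)
      ; b-inj = λ {i} {j} bi≡bj → toℕ-injective (b-injective (≤K i) (≤K j) bi≡bj)
      ; f≢b = λ i j → f≢b-everywhere (≤K i) (≤K j)
      ; f∈F = λ j → f∈F (≤K j)
      ; b∈F = λ j → b∈F (≤K j)
      }
      where
      ≤K : (j : Fin (suc K)) → toℕ j ≤ K
      ≤K = toℕ≤pred[n]

    tailVertex headVertex : ℕ → Fin (n + n)
    tailVertex j = tailAt j ↑ˡ n
    headVertex j = n ↑ʳ hd (f j)

    vertex : ℕ → Fin (n + n)
    vertex = interleave tailVertex headVertex

    edge : ℕ → Fin m
    edge = interleave f b

    edge-joins : ∀ {t} → t < twice (suc K) → Joins bipartiteGraph (edge t) (vertex t) (vertex (suc t))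
    edge-joins {t} t< with parity t
    ... | even j rewrite interleave-twice f b j | interleave-twice tailVertex headVertex j
                       | interleave-suc-twice tailVertex headVertex j =
      inj₁ (cong (_↑ˡ n) (sym (tailAt-f (twice-<⁻ t<))) , refl)
    ... | odd j rewrite interleave-suc-twice f b j | interleave-suc-twice tailVertex headVertex j
                      | interleave-twice tailVertex headVertex (suc j) =
      inj₂ (refl , cong (n ↑ʳ_) (hd-b (suc-twice-<⁻ t<)))

    edge∈F : ∀ {t} → t < twice (suc K) → edge t ∈ F
    edge∈F {t} t< with parity t
    ... | even j rewrite interleave-twice f b j = f∈F (twice-<⁻ t<)
    ... | odd j rewrite interleave-suc-twice f b j = b∈F (suc-twice-<⁻ t<)

    edge-injective : ∀ {s t} → s < twice (suc K) → t < twice (suc K) → edge s ≡ edge t → s ≡ t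
    edge-injective {s} {t} s< t< e with parity s | parity t
    ... | even i | even j rewrite interleave-twice f b i | interleave-twice f b j =
      cong twice (f-injective (twice-<⁻ s<) (twice-<⁻ t<) e)
    ... | odd i | odd j rewrite interleave-suc-twice f b i | interleave-suc-twice f b j =
      cong (suc ∘ twice) (b-injective (suc-twice-<⁻ s<) (suc-twice-<⁻ t<) e)
    ... | even i | odd j rewrite interleave-twice f b i | interleave-suc-twice f b j =
      ⊥-elim (f≢b-everywhere (twice-<⁻ s<) (suc-twice-<⁻ t<) e)
    ... | odd i | even j rewrite interleave-suc-twice f b i | interleave-twice f b j =
      ⊥-elim (f≢b-everywhere (twice-<⁻ t<) (suc-twice-<⁻ s<) (sym e))

    vertex-injective : ∀ {s t} → s < twice (suc K) → t < twice (suc K) → vertex s ≡ vertex t → s ≡ t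
    vertex-injective {s} {t} s< t< e with parity s | parity t
    ... | even i | even j rewrite interleave-twice tailVertex headVertex i | interleave-twice tailVertex headVertex j =
      cong twice (tl-inj (twice-<⁻ s<) (twice-<⁻ t<)
        (trans (sym (tailAt-f (twice-<⁻ s<))) (trans (↑ˡ-injective n _ _ e) (tailAt-f (twice-<⁻ t<)))))
    ... | odd i | odd j rewrite interleave-suc-twice tailVertex headVertex i | interleave-suc-twice tailVertex headVertex j =
      cong (suc ∘ twice) (hd-inj (suc-twice-<⁻ s<) (suc-twice-<⁻ t<) (↑ʳ-injective n _ _ e))
    ... | even i | odd j rewrite interleave-twice tailVertex headVertex i | interleave-suc-twice tailVertex headVertex j =
      ⊥-elim (↑ˡ≢↑ʳ _ _ e)
    ... | odd i | even j rewrite interleave-suc-twice tailVertex headVertex i | interleave-twice tailVertex headVertex j =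
      ⊥-elim (↑ˡ≢↑ʳ _ _ (sym e))

    cycle : Cycle bipartiteGraph F
    cycle = record
      { L = suc (twice K)
      ; x = vertex ∘ toℕ
      ; e = edge ∘ toℕ
      ; closed = cycle-closed
      ; joins = λ i → subst (λ v → Joins bipartiteGraph (edge (toℕ i)) v (vertex (suc (toℕ i))))
                            (cong vertex (sym (toℕ-inject₁ i))) (edge-joins (toℕ<n i))
      ; e-inj = λ {i} {j} e → toℕ-injective (edge-injective (toℕ<n i) (toℕ<n j) e)
      ; x-inj = cycle-x-inj
      ; e∈F = λ i → edge∈F (toℕ<n i)
      }
      where
      cycle-closed : vertex 0 ≡ vertex (toℕ (fromℕ (twice (suc K))))
      cycle-closed = sym (begin
        vertex (toℕ (fromℕ (twice (suc K)))) ≡⟨ cong vertex (toℕ-fromℕ (twice (suc K))) ⟩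
        vertex (twice (suc K))               ≡⟨ interleave-twice tailVertex headVertex (suc K) ⟩
        tl (b K) ↑ˡ n                        ≡⟨ cong (_↑ˡ n) closed ⟩
        vertex 0                             ∎)
        where open ≡-Reasoning
      cycle-x-inj : ∀ {i j : Fin (twice (suc K))} → vertex (toℕ (inject₁ i)) ≡ vertex (toℕ (inject₁ j)) → i ≡ j
      cycle-x-inj {i} {j} e rewrite toℕ-inject₁ i | toℕ-inject₁ j =
        toℕ-injective (vertex-injective (toℕ<n i) (toℕ<n j) e)

  trail⇒dependent : ∀ {F} → ClosedAntidirectedTrail D F → Dependent F
  trail⇒dependent {F} T = E , E⊆F , (arc zero , ∈-range arc zero) , deficient
    where
    open ClosedAntidirectedTrail T
    arc : Fin (suc k + suc k) → Fin m
    arc = [ f , b ]′ ∘ splitAt (suc k)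
    E : Subset m
    E = range arc
    trail-arc : ∀ {a} → a ∈ E → ∃ λ j → f j ≡ a ⊎ b j ≡ a
    trail-arc a∈E with ∈-image⁻ arc {p = ⊤} a∈E
    ... | i , _ , refl with splitAt (suc k) i
    ...   | inj₁ j = j , inj₁ refl
    ...   | inj₂ j = j , inj₂ refl
    E⊆F : E ⊆ F
    E⊆F a∈E with trail-arc a∈E
    ... | j , inj₁ refl = f∈F j
    ... | j , inj₂ refl = b∈F j
    heads⊆ : image hd E ⊆ range w
    heads⊆ v∈ with ∈-image⁻ hd {p = E} v∈
    ... | a , a∈E , refl with trail-arc a∈E
    ...   | j , inj₁ refl = subst (_∈ range w) (sym (proj₂ (f-fwd j))) (∈-range w j)
    ...   | j , inj₂ refl = subst (_∈ range w) (sym (proj₁ (b-bwd j))) (∈-range w j)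
    U : Subset n
    U = range (u ∘ inject₁)
    u∈U : ∀ i → u i ∈ U
    u∈U = closed⇒∈range u closed
    tails⊆ : image tl E ⊆ U
    tails⊆ v∈ with ∈-image⁻ tl {p = E} v∈
    ... | a , a∈E , refl with trail-arc a∈E
    ...   | j , inj₁ refl = subst (_∈ U) (sym (proj₁ (f-fwd j))) (u∈U (inject₁ j))
    ...   | j , inj₂ refl = subst (_∈ U) (sym (proj₂ (b-bwd j))) (u∈U (suc j))
    deficient : Deficient E
    deficient = begin
      h D E + t D E  ≤⟨ +-mono-≤ (≤-trans (p⊆q⇒∣p∣≤∣q∣ {p = image hd E} heads⊆) (∣range∣≤ w))
                                 (≤-trans (p⊆q⇒∣p∣≤∣q∣ {p = image tl E} tails⊆) (∣range∣≤ (u ∘ inject₁))) ⟩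
      suc k + suc k  ≤⟨ ≤∣range∣ ([,]∘splitAt-injective f-inj b-inj f≢b) ⟩
      ∣ E ∣          ∎
      where open ≤-Reasoning

  cycle⇒dependent : ∀ {F} → Cycle bipartiteGraph F → Dependent F
  cycle⇒dependent {F} C = E , E⊆F , (e zero , ∈-range e zero) , deficient
    where
    open Cycle C
    E : Subset m
    E = range e
    V : Subset (n + n)
    V = range (x ∘ inject₁)
    x∈V : ∀ i → x i ∈ V
    x∈V = closed⇒∈range x closed
    E⊆F : E ⊆ F
    E⊆F a∈E with ∈-image⁻ e {p = ⊤} a∈E
    ... | i , _ , refl = e∈F i
    ends∈V : ∀ i → tl (e i) ↑ˡ n ∈ V × n ↑ʳ hd (e i) ∈ V
    ends∈V i with joins i
    ... | inj₁ (tl≡ , hd≡) = subst (_∈ V) (sym tl≡) (x∈V (inject₁ i)) , subst (_∈ V) (sym hd≡) (x∈V (suc i))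
    ... | inj₂ (tl≡ , hd≡) = subst (_∈ V) (sym tl≡) (x∈V (suc i)) , subst (_∈ V) (sym hd≡) (x∈V (inject₁ i))
    heads⊆ : image hd E ⊆ rightPart n V
    heads⊆ v∈ with ∈-image⁻ hd {p = E} v∈
    ... | a , a∈E , refl with ∈-image⁻ e {p = ⊤} a∈E
    ...   | i , _ , refl = ∈-rightPart n (proj₂ (ends∈V i))
    tails⊆ : image tl E ⊆ leftPart n V
    tails⊆ v∈ with ∈-image⁻ tl {p = E} v∈
    ... | a , a∈E , refl with ∈-image⁻ e {p = ⊤} a∈E
    ...   | i , _ , refl = ∈-leftPart n (proj₁ (ends∈V i))
    deficient : Deficient E
    deficient = begin
      h D E + t D E                        ≤⟨ +-mono-≤ (p⊆q⇒∣p∣≤∣q∣ {p = image hd E} heads⊆)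
                                                       (p⊆q⇒∣p∣≤∣q∣ {p = image tl E} tails⊆) ⟩
      ∣ rightPart n V ∣ + ∣ leftPart n V ∣ ≡⟨ +-comm ∣ rightPart n V ∣ ∣ leftPart n V ∣ ⟩
      ∣ leftPart n V ∣ + ∣ rightPart n V ∣ ≡⟨ sym (∣p∣≡∣leftPart∣+∣rightPart∣ n n V) ⟩
      ∣ V ∣                                ≤⟨ ∣range∣≤ (x ∘ inject₁) ⟩
      suc L                                ≤⟨ ≤∣range∣ e-inj ⟩
      ∣ E ∣                                ∎
      where open ≤-Reasoning

  simple⇒trail : ∀ {F} → SimpleClosedAltWalk F → ClosedAntidirectedTrail D F
  simple⇒trail (_ , W , simple) = SimpleWalk.trail W simple

  simple⇒cycle : ∀ {F} → SimpleClosedAltWalk F → Cycle bipartiteGraph F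
  simple⇒cycle (_ , W , simple) = SimpleWalk.cycle W simple

  independent⇔X-free : {X : Subset m → Set} → (∀ {F} → X F → Dependent F) →
    (∀ {F} → SimpleClosedAltWalk F → X F) → ∀ {I} → Independent D I ⇔ (¬ X I)
  independent⇔X-free X⇒dependent simple⇒X {I} = mk⇔
    (λ independent x → dependent⇒¬independent (X⇒dependent x) independent)
    (λ no-x → [ id , (λ dependent → ⊥-elim (no-x (simple⇒X (dependent⇒simpleClosedAltWalk dependent)))) ]′
               (independent⊎dependent I))

  independent⇔trailFree : ∀ {I} → Independent D I ⇔ NoClosedAntidirectedTrail D I
  independent⇔trailFree = independent⇔X-free trail⇒dependent simple⇒trail

  independent⇔acyclic : ∀ {I} → Independent D I ⇔ Acyclic bipartiteGraph I
  independent⇔acyclic = independent⇔X-free cycle⇒dependent simple⇒cycle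

theorem5p2 : (D : Digraph) →
    IsGraphic (Digraph.m D) (Independent D) ×
    Σ ℕ (λ r → IsRank (Independent D) r × IsMaxSize (NoClosedAntidirectedTrail D) r)
theorem5p2 D with largest (independent? D) (∅-independent D)
... | S , S-independent , S-largest =
  (bipartiteGraph D , λ I → independent⇔acyclic D) ,
  ∣ S ∣ ,
  ((S , S-independent , refl) , S-largest) ,
  ((S , Equivalence.to (independent⇔trailFree D) S-independent , refl) ,
   λ S′ → S-largest S′ ∘ Equivalence.from (independent⇔trailFree D))
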